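{- Let $n \ge 0$ be an integer and let $\theta^{(n)} = (n+2, 2, 1^n)$. Define $\psi : \mathrm{SYT}(\theta^{(n)}) \to \mathcal{P}_n$ by sending a tableau $T$ to the word $\psi(T) = p_1 p_2 \cdots p_{2n+2}$ where, for $1 \le i \le 2n+2$, \[ p_i = \begin{cases} \mathsf{E}, & \text{if } i+2 \in \mathrm{arm}(T);\\ \mathsf{N}, & \text{if } i+2 \in \mathrm{leg}(T);\\ \mathsf{S}, & \text{if } i+2 \in \mathrm{heart}(T) \text{ and } 2 \in \mathrm{arm}(T);\\ \mathsf{W}, & \text{if } i+2 \in \mathrm{heart}(T) \text{ and } 2 \in \mathrm{leg}(T). \end{cases} \] Then $\psi$ is a well-defined bijection from $\mathrm{SYT}(\theta^{(n)})$ to $\mathcal{P}_n$.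
   Context: For an integer $n\ge 0$, $\theta^{(n)}$ denotes the partition $(n+2,2,1^n)$ of $2n+4$ (first row of length $n+2$, second row of length $2$, then $n$ rows of length $1$), identified with its Young diagram in English convention (longest row on top). $\mathrm{SYT}(\theta^{(n)})$ is the set of standard Young tableaux of this shape: bijective fillings of the boxes with $1,\dots,2n+4$ increasing left to right along rows and top to bottom down columns. The arm of a tableau is the set of entries in the first row, the leg is the set of entries in the first column (the top-left box belongs to both), and the heart is the entry in the unique box in neither the first row nor the first column (the box in row 2, column 2). $\mathcal{P}_n$ is the set of lattice paths from $(0,0)$ to $(n,n)$ of length $2n+2$, using steps $\mathsf{N}=(0,1)$, $\mathsf{S}=(0,-1)$, $\mathsf{E}=(1,0)$, $\mathsf{W}=(-1,0)$, that stay weakly inside the first quadrant (all visited points have both coordinates $\ge 0$); such paths are written as words in the letters $\mathsf{N},\mathsf{S},\mathsf{E},\mathsf{W}$. -}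

module Defs where

open import Data.Nat using (ℕ; zero; suc; _+_; _*_; _<_)
open import Data.Nat.ListAction using (sum)
open import Data.List using (List; []; _∷_; replicate)
open import Data.Vec using (Vec; lookup; toList)
open import Data.Fin using (Fin; toℕ)
open import Data.Product using (Σ; Σ-syntax; ∃; _×_; _,_)
open import Data.Maybe using (Maybe; just; nothing; _>>=_)
open import Relation.Binary.PropositionalEquality using (_≡_)

-- Young diagrams (English convention), given by the list of row lengths.
-- Rows and columns are indexed from 0: row 0 is the top row, column 0
-- the leftmost column.

rowLen : List ℕ → ℕ → ℕ
rowLen []       _       = 0
rowLen (l ∷ ls) zero    = l
rowLen (l ∷ ls) (suc r) = rowLen ls r

Cell : List ℕ → Set
Cell sh = Σ[ r ∈ ℕ ] Σ[ c ∈ ℕ ] (c < rowLen sh r)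

size : List ℕ → ℕ
size sh = sum sh

-- Standard Young tableau: a bijective filling of the boxes with
-- 1, …, |sh|; the filling value k : Fin |sh| stands for the entry toℕ k + 1.
record SYT (sh : List ℕ) : Set where
  field
    fill      : Cell sh → Fin (size sh)
    fill-inj  : ∀ x y → fill x ≡ fill y → x ≡ y
    fill-surj : ∀ k → ∃ λ x → fill x ≡ k
    row-incr  : ∀ r c c' (p : c < rowLen sh r) (p' : c' < rowLen sh r) →
                c < c' → toℕ (fill (r , c , p)) < toℕ (fill (r , c' , p'))
    col-incr  : ∀ r r' c (p : c < rowLen sh r) (p' : c < rowLen sh r') →
                r < r' → toℕ (fill (r , c , p)) < toℕ (fill (r' , c , p'))

  entry : Cell sh → ℕ
  entry x = suc (toℕ (fill x))

open SYT public

θ : ℕ → List ℕ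
θ n = (n + 2) ∷ 2 ∷ replicate n 1

InArm : ∀ {n} → SYT (θ n) → ℕ → Set
InArm {n} T k = Σ[ c ∈ ℕ ] Σ[ p ∈ c < rowLen (θ n) 0 ] entry T (0 , c , p) ≡ k

InLeg : ∀ {n} → SYT (θ n) → ℕ → Set
InLeg {n} T k = Σ[ r ∈ ℕ ] Σ[ p ∈ 0 < rowLen (θ n) r ] entry T (r , 0 , p) ≡ k

-- the box in row 2, column 2 (indices (1,1)); 1 < 2 = rowLen (θ n) 1
heartCell : ∀ n → Cell (θ n)
heartCell n = 1 , 1 , Data.Nat.s≤s (Data.Nat.s≤s Data.Nat.z≤n)

IsHeart : ∀ {n} → SYT (θ n) → ℕ → Set
IsHeart {n} T k = entry T (heartCell n) ≡ k

data Step : Set where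
  N S E W : Step

-- Walk from a point; returns nothing as soon as a coordinate would become
-- negative (i.e. the path leaves the first quadrant).
walk : ℕ × ℕ → List Step → Maybe (ℕ × ℕ)
walk p                   []       = just p
walk (x , y)             (N ∷ ws) = walk (x , suc y) ws
walk (x , y)             (E ∷ ws) = walk (suc x , y) ws
walk (x , zero)          (S ∷ ws) = nothing
walk (x , suc y)         (S ∷ ws) = walk (x , y) ws
walk (zero , y)          (W ∷ ws) = nothing
walk (suc x , y)         (W ∷ ws) = walk (x , y) ws

Word : ℕ → Set
Word n = Vec Step (2 * n + 2)

-- membership in 𝒫ₙ: from (0,0) to (n,n), staying in the first quadrant
InP : ∀ n → Word n → Set
InP n w = walk (0 , 0) (toList w) ≡ just (n , n)

-- The defining conditions of ψ(T) = p₁ ⋯ p_{2n+2}: position i (0-based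
-- index j, so i = j+1) concerns the entry i+2 = j+3.

ψRel : ∀ n → SYT (θ n) → Word n → Set
ψRel n T w = ∀ (j : Fin (2 * n + 2)) →
  let k = toℕ j + 3 ; p = lookup w j in
    (InArm T k → p ≡ E)
  × (InLeg T k → p ≡ N)
  × (IsHeart T k → InArm T 2 → p ≡ S)
  × (IsHeart T k → InLeg T 2 → p ≡ W)

SameSYT : ∀ {sh} → SYT sh → SYT sh → Set
SameSYT T T' = ∀ x → fill T x ≡ fill T' x

module Submission where

-- Record for each value v (the entry v+1) the region of its box: the arm, the leg below the
-- corner, or the heart. Within a region the boxes are filled increasingly, so the box of index k
-- holds the unique value of that region preceded by exactly k values of the same region. Hence a
-- tableau is determined by its region word, and the region words of tableaux are exactly those
-- that start in the arm, have n+2 arm, n+1 leg and one heart value, and place the heart after two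
-- arm values and one leg value. ψ reads the region word from value 2 on as E (arm), N (leg) and
-- S or W (heart, according to the region of value 1). In terms of step counts, the totals say that
-- the walk ends at (n , n), and the position of the heart says that the single backward step never
-- leaves the quadrant.

open import Defs
open import Data.Bool using (Bool; true; false; not; if_then_else_)
open import Data.Empty using (⊥-elim)
open import Data.Fin as Fin using (Fin; toℕ; fromℕ<)
open import Data.Fin.Properties using (toℕ-injective; toℕ<n; toℕ-fromℕ<)
open import Data.List using ([]; _∷_; _++_; applyUpTo; replicate)
open import Data.List.Properties using (applyUpTo-∷ʳ)
open import Data.Maybe using (just; nothing; _>>=_)
open import Data.Nat using (ℕ; zero; suc; _+_; _*_; _≤_; _<_; z≤n; s≤s; s≤s⁻¹; _≤?_; _<?_)
open import Data.Nat.ListAction using (sum)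
open import Data.Nat.Properties
open import Data.Nat.Tactic.RingSolver using (solve-∀)
open import Data.Product using (Σ; ∃₂; _×_; _,_; proj₁; proj₂)
open import Data.Sum using (_⊎_; inj₁; inj₂)
open import Data.Unit using (⊤; tt)
open import Data.Vec using (Vec; []; _∷_; toList; lookup; tabulate)
open import Data.Vec.Properties using (lookup∘tabulate; tabulate∘lookup; tabulate-cong)
open import Relation.Binary.Definitions using (tri<; tri≈; tri>)
open import Relation.Binary.PropositionalEquality
open import Relation.Nullary using (yes; no)

count : (ℕ → Bool) → ℕ → ℕ
count P zero    = 0
count P (suc k) = if P k then suc (count P k) else count P k

module _ {P : ℕ → Bool} where

  count-suc-true : ∀ {k} → P k ≡ true → count P (suc k) ≡ suc (count P k)
  count-suc-true eq rewrite eq = refl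

  count-mono : ∀ {a b} → a ≤ b → count P a ≤ count P b
  count-mono {b = zero}  z≤n = ≤-refl
  count-mono {a} {suc b} a≤b with m≤n⇒m<n∨m≡n a≤b
  ... | inj₂ refl = ≤-refl
  ... | inj₁ (s≤s a≤b′) with P b
  ...   | true  = m≤n⇒m≤1+n (count-mono a≤b′)
  ...   | false = count-mono a≤b′

  count-< : ∀ {u v} → u < v → P u ≡ true → count P u < count P v
  count-< u<v Pu = ≤-trans (≤-reflexive (sym (count-suc-true Pu))) (count-mono u<v)

  count-cancel-< : ∀ {u v} → count P u < count P v → u < v
  count-cancel-< lt = ≰⇒> λ v≤u → <⇒≱ lt (count-mono v≤u)

  count-injective : ∀ {u v} → P u ≡ true → P v ≡ true → count P u ≡ count P v → u ≡ v
  count-injective {u} {v} Pu Pv eq with <-cmp u v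
  ... | tri< u<v _ _ = ⊥-elim (<-irrefl eq (count-< u<v Pu))
  ... | tri≈ _ u≡v _ = u≡v
  ... | tri> _ _ v<u = ⊥-elim (<-irrefl (sym eq) (count-< v<u Pv))

  count-select : ∀ {c k} → c < count P k → Σ ℕ λ v → v < k × P v ≡ true × count P v ≡ c
  count-select {k = suc k} c<count with P k in Pk
  ... | false = let v , v<k , Pv , eq = count-select c<count in v , m≤n⇒m≤1+n v<k , Pv , eq
  ... | true with m≤n⇒m<n∨m≡n (s≤s⁻¹ c<count)
  ...   | inj₁ c<count′ = let v , v<k , Pv , eq = count-select c<count′ in v , m≤n⇒m≤1+n v<k , Pv , eq
  ...   | inj₂ refl     = k , ≤-refl , Pk , refl

  count-interval : ∀ {a b} → a ≤ b → (∀ {u} → a ≤ u → u < b → P u ≡ false) →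
                   count P b ≡ count P a
  count-interval {b = zero}  z≤n _ = refl
  count-interval {a} {suc b} a≤b none with m≤n⇒m<n∨m≡n a≤b
  ... | inj₂ refl = refl
  ... | inj₁ (s≤s a≤b′) rewrite none a≤b′ ≤-refl =
    count-interval a≤b′ λ a≤u u<b → none a≤u (m≤n⇒m≤1+n u<b)

  count-false : ∀ {k u} → count P k ≡ 0 → u < k → P u ≡ false
  count-false {u = u} eq u<k with P u in Pu
  ... | false = refl
  ... | true  = ⊥-elim (m<n⇒n≢0 (count-< u<k Pu) eq)

count-≤ : ∀ (P : ℕ → Bool) k → count P k ≤ k
count-≤ P zero    = z≤n
count-≤ P (suc k) with P k
... | true  = s≤s (count-≤ P k)
... | false = m≤n⇒m≤1+n (count-≤ P k)

count-cong : ∀ {P Q : ℕ → Bool} k → (∀ {u} → u < k → P u ≡ Q u) → count P k ≡ count Q k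
count-cong zero    _  = refl
count-cong {P} {Q} (suc k) eq rewrite eq (n<1+n k) with Q k
... | true  = cong suc (count-cong k λ u<k → eq (m≤n⇒m≤1+n u<k))
... | false = count-cong k λ u<k → eq (m≤n⇒m≤1+n u<k)

count-+ : ∀ (P : ℕ → Bool) k i → count P (k + i) ≡ count P k + count (λ u → P (k + u)) i
count-+ P k zero    = trans (cong (count P) (+-identityʳ k)) (sym (+-identityʳ (count P k)))
count-+ P k (suc i) rewrite +-suc k i with P (k + i)
... | true  = trans (cong suc (count-+ P k i)) (sym (+-suc _ _))
... | false = count-+ P k i

module Enumeration (P : ℕ → Bool) {len bound : ℕ} (g : ∀ i → i < len → ℕ)
  (g-irrelevant : ∀ {i} (p q : i < len) → g i p ≡ g i q)
  (g-increasing : ∀ {i j} (p : i < len) (q : j < len) → i < j → g i p < g j q)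
  (g-true : ∀ {i} (p : i < len) → P (g i p) ≡ true)
  (g-bounded : ∀ {i} (p : i < len) → g i p < bound)
  (g-onto : ∀ {u} → u < bound → P u ≡ true → ∃₂ λ i (p : i < len) → g i p ≡ u)
  where

  private
    g-monotone : ∀ {i j} (p : i < len) (q : j < len) → i ≤ j → g i p ≤ g j q
    g-monotone p q i≤j with m≤n⇒m<n∨m≡n i≤j
    ... | inj₁ i<j  = <⇒≤ (g-increasing p q i<j)
    ... | inj₂ refl = ≤-reflexive (g-irrelevant p q)

    count-gap : ∀ {a b} → a ≤ b → b ≤ bound → (∀ {i} (p : i < len) → g i p < a ⊎ b ≤ g i p) →
                count P b ≡ count P a
    count-gap {a} {b} a≤b b≤bound outside = count-interval a≤b no-hit
      where
      no-hit : ∀ {u} → a ≤ u → u < b → P u ≡ false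
      no-hit {u} a≤u u<b with P u in Pu
      ... | false = refl
      ... | true with g-onto (<-≤-trans u<b b≤bound) Pu
      ...   | i , p , refl with outside p
      ...     | inj₁ g<a = ⊥-elim (<⇒≱ g<a a≤u)
      ...     | inj₂ b≤g = ⊥-elim (<⇒≱ u<b b≤g)

    count-below : ∀ l {b} → l ≤ len → b ≤ bound →
                  (∀ {i} (p : i < len) → i < l → g i p < b) →
                  (∀ {i} (p : i < len) → l ≤ i → b ≤ g i p) →
                  count P b ≡ l
    count-below zero    _   b≤bound _     above = count-gap z≤n b≤bound λ p → inj₂ (above p z≤n)
    count-below (suc l) {b} p b≤bound below above = begin
      count P b             ≡⟨ count-gap (below p (n<1+n l)) b≤bound outside ⟩
      count P (suc (g l p)) ≡⟨ count-suc-true {P = P} (g-true p) ⟩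
      suc (count P (g l p)) ≡⟨ cong suc (count-below l (<⇒≤ p) (<⇒≤ (g-bounded p))
                                           (λ q → g-increasing q p) (λ q → g-monotone p q)) ⟩
      suc l                 ∎
      where
      open ≡-Reasoning
      outside : ∀ {i} (q : i < len) → g i q < suc (g l p) ⊎ b ≤ g i q
      outside {i} q with i ≤? l
      ... | yes i≤l = inj₁ (s≤s (g-monotone q p i≤l))
      ... | no  i≰l = inj₂ (above q (≰⇒> i≰l))

  count-at : ∀ {i} (p : i < len) → count P (g i p) ≡ i
  count-at p = count-below _ (<⇒≤ p) (<⇒≤ (g-bounded p)) (λ q → g-increasing q p) (λ q → g-monotone p q)

  count-total : count P bound ≡ len
  count-total = count-below len ≤-refl ≤-refl (λ p _ → g-bounded p) λ p len≤i → ⊥-elim (<⇒≱ p len≤i)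

rowLen-replicate-≤1 : ∀ n r → rowLen (replicate n 1) r ≤ 1
rowLen-replicate-≤1 zero    r       = z≤n
rowLen-replicate-≤1 (suc n) zero    = ≤-refl
rowLen-replicate-≤1 (suc n) (suc r) = rowLen-replicate-≤1 n r

rowLen-replicate-pos : ∀ {n r} → r < n → 0 < rowLen (replicate n 1) r
rowLen-replicate-pos {suc n} {zero}  _         = s≤s z≤n
rowLen-replicate-pos {suc n} {suc r} (s≤s r<n) = rowLen-replicate-pos r<n

rowLen-replicate-pos⁻¹ : ∀ {n r} → 0 < rowLen (replicate n 1) r → r < n
rowLen-replicate-pos⁻¹ {suc n} {zero}  _ = s≤s z≤n
rowLen-replicate-pos⁻¹ {suc n} {suc r} p = s≤s (rowLen-replicate-pos⁻¹ p)

θ-row-nonempty : ∀ {n r} → r < suc n → 0 < rowLen (θ n) (suc r)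
θ-row-nonempty {r = zero}  _         = s≤s z≤n
θ-row-nonempty {r = suc r} (s≤s r<n) = rowLen-replicate-pos r<n

θ-row-nonempty⁻¹ : ∀ {n} r → 0 < rowLen (θ n) (suc r) → r < suc n
θ-row-nonempty⁻¹ zero    _ = s≤s z≤n
θ-row-nonempty⁻¹ (suc r) p = s≤s (rowLen-replicate-pos⁻¹ p)

θ-lower-row-≤2 : ∀ n r → rowLen (θ n) (suc r) ≤ 2
θ-lower-row-≤2 n zero    = ≤-refl
θ-lower-row-≤2 n (suc r) = m≤n⇒m≤1+n (rowLen-replicate-≤1 n r)

θ-heart-position : ∀ {n r c} → suc c < rowLen (θ n) (suc r) → r ≡ 0 × c ≡ 0
θ-heart-position {r = zero}  {zero}  _                 = refl , refl
θ-heart-position {r = zero}  {suc c} (s≤s (s≤s ()))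
θ-heart-position {n} {suc r} p = ⊥-elim (<⇒≱ (≤-trans (s≤s (s≤s z≤n)) p) (rowLen-replicate-≤1 n r))

size-θ : ∀ n → size (θ n) ≡ 2 + (2 * n + 2)
size-θ n = trans (cong (λ k → n + 2 + (2 + k)) (sum-replicate n)) (arith n)
  where
  sum-replicate : ∀ n → sum (replicate n 1) ≡ n
  sum-replicate zero    = refl
  sum-replicate (suc n) = cong suc (sum-replicate n)
  arith : ∀ n → n + 2 + (2 + n) ≡ 2 + (2 * n + 2)
  arith = solve-∀

<size : ∀ {n v} → v < 2 + (2 * n + 2) → v < size (θ n)
<size {n} {v} = subst (v <_) (sym (size-θ n))

cell-irrelevant : ∀ {n r c} {p q : c < rowLen (θ n) r} → _≡_ {A = Cell (θ n)} (r , c , p) (r , c , q)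
cell-irrelevant {p = p} {q} = cong (λ p → _ , _ , p) (<-irrelevant p q)

heart-unique : ∀ {n r c} (p : suc c < rowLen (θ n) (suc r)) → (suc r , suc c , p) ≡ heartCell n
heart-unique {n} {r} {c} p with θ-heart-position {n} {r} {c} p
... | refl , refl = cell-irrelevant

-- The corner box lies in both the arm and the leg of the paper; here it counts as arm,
-- so `leg` is the part of the first column below the corner.
data Region : Set where
  arm leg heart : Region

_=ᴿ_ : Region → Region → Bool
arm   =ᴿ arm   = true
leg   =ᴿ leg   = true
heart =ᴿ heart = true
_     =ᴿ _     = false

=ᴿ-refl : ∀ ρ → (ρ =ᴿ ρ) ≡ true
=ᴿ-refl arm   = refl
=ᴿ-refl leg   = refl
=ᴿ-refl heart = refl

=ᴿ⇒≡ : ∀ {ρ σ} → (ρ =ᴿ σ) ≡ true → ρ ≡ σ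
=ᴿ⇒≡ {arm}   {arm}   _ = refl
=ᴿ⇒≡ {leg}   {leg}   _ = refl
=ᴿ⇒≡ {heart} {heart} _ = refl

regionSize : ℕ → Region → ℕ
regionSize n arm   = n + 2
regionSize n leg   = suc n
regionSize n heart = 1

region : ∀ {n} → Cell (θ n) → Region
region (zero  , _     , _) = arm
region (suc _ , zero  , _) = leg
region (suc _ , suc _ , _) = heart

index : ∀ {n} → Cell (θ n) → ℕ
index (zero  , c     , _) = c
index (suc r , zero  , _) = r
index (suc _ , suc _ , _) = 0

index<regionSize : ∀ {n} (x : Cell (θ n)) → index x < regionSize n (region x)
index<regionSize (zero  , _     , p) = p
index<regionSize (suc r , zero  , p) = θ-row-nonempty⁻¹ r p
index<regionSize (suc _ , suc _ , _) = s≤s z≤n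

cellAt : ∀ {n} ρ i → i < regionSize n ρ → Cell (θ n)
cellAt     arm   c p = zero , c , p
cellAt     leg   r p = suc r , zero , θ-row-nonempty p
cellAt {n} heart _ _ = heartCell n

region-cellAt : ∀ {n} ρ {i} (p : i < regionSize n ρ) → region (cellAt ρ i p) ≡ ρ
region-cellAt arm   _ = refl
region-cellAt leg   _ = refl
region-cellAt heart _ = refl

cellAt-irrelevant : ∀ {n} ρ {i} (p q : i < regionSize n ρ) → cellAt ρ i p ≡ cellAt ρ i q
cellAt-irrelevant arm   _ _ = cell-irrelevant
cellAt-irrelevant leg   _ _ = cell-irrelevant
cellAt-irrelevant heart _ _ = refl

cellAt-coordinates : ∀ {n} (x : Cell (θ n)) → cellAt (region x) (index x) (index<regionSize x) ≡ x
cellAt-coordinates (zero  , _     , _) = refl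
cellAt-coordinates (suc _ , zero  , _) = cell-irrelevant
cellAt-coordinates (suc _ , suc _ , p) = sym (heart-unique p)

coordinates-injective : ∀ {n} {x y : Cell (θ n)} → region x ≡ region y → index x ≡ index y → x ≡ y
coordinates-injective {x = x} {y} ρ≡ i≡ = begin
  x                                                ≡⟨ cellAt-coordinates x ⟨
  cellAt (region x) (index x) (index<regionSize x) ≡⟨ move ρ≡ i≡ ⟩
  cellAt (region y) (index y) (index<regionSize y) ≡⟨ cellAt-coordinates y ⟩
  y                                                ∎
  where
  open ≡-Reasoning
  move : ∀ {ρ σ i j p q} → ρ ≡ σ → i ≡ j → cellAt ρ i p ≡ cellAt σ j q
  move {ρ} refl refl = cellAt-irrelevant ρ _ _

region≡heart : ∀ {n} (x : Cell (θ n)) → region x ≡ heart → x ≡ heartCell n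
region≡heart (suc _ , suc _ , p) _ = heart-unique p

_is_ : (ℕ → Region) → Region → ℕ → Bool
(cl is ρ) v = cl v =ᴿ ρ

is-true : ∀ {cl : ℕ → Region} {v ρ} → cl v ≡ ρ → (cl is ρ) v ≡ true
is-true {ρ = ρ} refl = =ᴿ-refl ρ

record Admissible (n : ℕ) (cl : ℕ → Region) : Set where
  field
    starts-in-arm   : cl 0 ≡ arm
    region-count    : ∀ ρ → count (cl is ρ) (size (θ n)) ≡ regionSize n ρ
    heart-after-leg : ∀ {v} → v < size (θ n) → cl v ≡ heart → 1 ≤ count (cl is leg) v
    heart-after-arm : ∀ {v} → v < size (θ n) → cl v ≡ heart → 2 ≤ count (cl is arm) v

module _ {n} {cl : ℕ → Region} (adm : Admissible n cl) where
  open Admissible adm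

  second-not-heart : cl 1 ≢ heart
  second-not-heart h = <⇒≱ (heart-after-arm (<size {n} (s≤s (s≤s z≤n))) h) (count-≤ (cl is arm) 1)

  region-count-θ : ∀ ρ → count (cl is ρ) (2 + (2 * n + 2)) ≡ regionSize n ρ
  region-count-θ ρ = subst (λ k → count (cl is ρ) k ≡ regionSize n ρ) (size-θ n) (region-count ρ)

  no-heart-before-heart : ∀ {v} → v < size (θ n) → cl v ≡ heart → count (cl is heart) v ≡ 0
  no-heart-before-heart {v} v<size isHeart =
    n≤0⇒n≡0 (s≤s⁻¹ (subst (count (cl is heart) v <_) (region-count heart)
                             (count-< {P = cl is heart} v<size (is-true {cl} isHeart))))

Admissible-cong : ∀ {n cl cl′} → (∀ v → cl v ≡ cl′ v) → Admissible n cl → Admissible n cl′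
Admissible-cong {n} {cl} {cl′} same adm = record
  { starts-in-arm   = trans (sym (same 0)) starts-in-arm
  ; region-count    = λ ρ → trans (sym (counts ρ (size (θ n)))) (region-count ρ)
  ; heart-after-leg = λ {v} v<size h → subst (1 ≤_) (counts leg v) (heart-after-leg v<size (trans (same v) h))
  ; heart-after-arm = λ {v} v<size h → subst (2 ≤_) (counts arm v) (heart-after-arm v<size (trans (same v) h))
  }
  where
  open Admissible adm
  counts : ∀ ρ k → count (cl is ρ) k ≡ count (cl′ is ρ) k
  counts ρ k = count-cong k λ {u} _ → cong (_=ᴿ ρ) (same u)

value : ∀ {n} → SYT (θ n) → Cell (θ n) → ℕ
value T x = toℕ (fill T x)

module _ {n} (T : SYT (θ n)) where

  value-injective : ∀ {x y} → value T x ≡ value T y → x ≡ y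
  value-injective {x} {y} eq = fill-inj T x y (toℕ-injective eq)

  cellOf : ∀ {v} → v < size (θ n) → Σ (Cell (θ n)) λ x → value T x ≡ v
  cellOf v<size with fill-surj T (fromℕ< v<size)
  ... | x , eq = x , trans (cong toℕ eq) (toℕ-fromℕ< v<size)

  -- The region of the box holding the value v, where values are entries minus one; junk beyond the size.
  regionOf : ℕ → Region
  regionOf v with v <? size (θ n)
  ... | yes v<size = region (proj₁ (cellOf v<size))
  ... | no  _      = heart

  regionOf-value : ∀ x → regionOf (value T x) ≡ region x
  regionOf-value x with value T x <? size (θ n)
  ... | yes p = cong region (value-injective (proj₂ (cellOf p)))
  ... | no ¬p = ⊥-elim (¬p (toℕ<n (fill T x)))

  value-corner : ∀ p → value T (0 , 0 , p) ≡ 0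
  value-corner p with cellOf (<size {n} (s≤s z≤n))
  ... | (zero , zero , q) , eq = trans (cong (value T) cell-irrelevant) eq
  ... | (zero , suc c , q) , eq =
    ⊥-elim (n≮0 (subst (value T (0 , 0 , p) <_) eq (row-incr T 0 0 (suc c) p q (s≤s z≤n))))
  ... | (suc r , c , q) , eq =
    ⊥-elim (n≮0 (subst (value T (0 , c , c<) <_) eq (col-incr T 0 (suc r) c c< q (s≤s z≤n))))
    where
    c< : c < n + 2
    c< = <-≤-trans q (≤-trans (θ-lower-row-≤2 n r) (m≤n+m 2 n))

  value-cellAt-increasing : ∀ ρ {i j} (p : i < regionSize n ρ) (q : j < regionSize n ρ) → i < j →
                            value T (cellAt ρ i p) < value T (cellAt ρ j q)
  value-cellAt-increasing arm   p q i<j = row-incr T 0 _ _ p q i<j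
  value-cellAt-increasing leg   p q i<j = col-incr T (suc _) (suc _) 0 _ _ (s≤s i<j)
  value-cellAt-increasing heart (s≤s z≤n) (s≤s z≤n) ()

  cellAt-onto : ∀ ρ {u} → u < size (θ n) → (regionOf is ρ) u ≡ true →
                ∃₂ λ i (p : i < regionSize n ρ) → value T (cellAt ρ i p) ≡ u
  cellAt-onto ρ u<size inρ with cellOf u<size
  ... | x , refl with =ᴿ⇒≡ (subst (λ σ → (σ =ᴿ ρ) ≡ true) (regionOf-value x) inρ)
  ...   | refl = index x , index<regionSize x , cong (value T) (cellAt-coordinates x)

  module RegionEnumeration (ρ : Region) =
    Enumeration (regionOf is ρ) (λ i p → value T (cellAt ρ i p))
      (λ p q → cong (value T) (cellAt-irrelevant ρ p q))
      (value-cellAt-increasing ρ)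
      (λ p → is-true {regionOf} (trans (regionOf-value _) (region-cellAt ρ p)))
      (λ _ → toℕ<n _)
      (cellAt-onto ρ)

  rank-value : ∀ x → count (regionOf is region x) (value T x) ≡ index x
  rank-value x = subst (λ y → count (regionOf is region x) (value T y) ≡ index x) (cellAt-coordinates x)
                       (RegionEnumeration.count-at (region x) (index<regionSize x))

  rank-below : ∀ x {v} → value T x < v → suc (index x) ≤ count (regionOf is region x) v
  rank-below x {v} lt = subst (λ k → suc k ≤ count (regionOf is region x) v) (rank-value x)
                              (count-< {P = regionOf is region x} lt (is-true {regionOf} (regionOf-value x)))

  heart-value : ∀ {v} → v < size (θ n) → regionOf v ≡ heart → value T (heartCell n) ≡ v
  heart-value v<size isHeart with cellOf v<size
  ... | x , refl = cong (value T) (sym (region≡heart x (trans (sym (regionOf-value x)) isHeart)))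

  regionOf-admissible : Admissible n regionOf
  regionOf-admissible = record
    { starts-in-arm   = trans (cong regionOf (sym (value-corner 0<n+2))) (regionOf-value _)
    ; region-count    = RegionEnumeration.count-total
    ; heart-after-leg = λ v<size isHeart →
        subst (λ v → 1 ≤ count (regionOf is leg) v) (heart-value v<size isHeart)
              (rank-below (1 , 0 , s≤s z≤n) (row-incr T 1 0 1 _ _ (s≤s z≤n)))
    ; heart-after-arm = λ v<size isHeart →
        subst (λ v → 2 ≤ count (regionOf is arm) v) (heart-value v<size isHeart)
              (rank-below (0 , 1 , m≤n+m 2 n) (col-incr T 0 1 1 _ _ (s≤s z≤n)))
    }
    where
    0<n+2 : 0 < n + 2
    0<n+2 = <-≤-trans (s≤s z≤n) (m≤n+m 2 n)

same-regions⇒SameSYT : ∀ {n} (T T′ : SYT (θ n)) →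
                       (∀ {v} → v < size (θ n) → regionOf T v ≡ regionOf T′ v) → SameSYT T T′
same-regions⇒SameSYT T T′ same x = toℕ-injective (count-injective {P = P} inT inT′ ranks)
  where
  open ≡-Reasoning
  P : ℕ → Bool
  P = regionOf T is region x
  inT : P (value T x) ≡ true
  inT = is-true {regionOf T} (regionOf-value T x)
  inT′ : P (value T′ x) ≡ true
  inT′ = is-true {regionOf T} (trans (same (toℕ<n _)) (regionOf-value T′ x))
  ranks : count P (value T x) ≡ count P (value T′ x)
  ranks = begin
    count P (value T x)                          ≡⟨ rank-value T x ⟩
    index x                                      ≡⟨ rank-value T′ x ⟨
    count (regionOf T′ is region x) (value T′ x) ≡⟨ count-cong (value T′ x) agree ⟨
    count P (value T′ x)                         ∎
    where
    agree : ∀ {u} → u < value T′ x → P u ≡ (regionOf T′ is region x) u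
    agree u<v = cong (_=ᴿ region x) (same (<-trans u<v (toℕ<n (fill T′ x))))

module FromRegions {n} {cl : ℕ → Region} (adm : Admissible n cl) where
  open Admissible adm

  private
    select : ∀ ρ {i} → i < regionSize n ρ →
             Σ ℕ λ v → v < size (θ n) × (cl is ρ) v ≡ true × count (cl is ρ) v ≡ i
    select ρ {i} p = count-select (subst (i <_) (sym (region-count ρ)) p)

    valueAt : Cell (θ n) → ℕ
    valueAt x = proj₁ (select (region x) (index<regionSize x))

    valueAt<size : ∀ x → valueAt x < size (θ n)
    valueAt<size x = proj₁ (proj₂ (select (region x) (index<regionSize x)))

    valueAt-region : ∀ x → cl (valueAt x) ≡ region x
    valueAt-region x = =ᴿ⇒≡ (proj₁ (proj₂ (proj₂ (select (region x) (index<regionSize x)))))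

    valueAt-rank : ∀ x → count (cl is region x) (valueAt x) ≡ index x
    valueAt-rank x = proj₂ (proj₂ (proj₂ (select (region x) (index<regionSize x))))

    valueAt-cellAt : ∀ ρ {i} (p : i < regionSize n ρ) → valueAt (cellAt ρ i p) ≡ proj₁ (select ρ p)
    valueAt-cellAt arm   _         = refl
    valueAt-cellAt leg   p         = cong (λ q → proj₁ (select leg q)) (<-irrelevant _ p)
    valueAt-cellAt heart (s≤s z≤n) = refl

    valueAt-< : ∀ x {v} → index x < count (cl is region x) v → valueAt x < v
    valueAt-< x lt = count-cancel-< {P = cl is region x} (subst (_< _) (sym (valueAt-rank x)) lt)

    valueAt-row : ∀ r c c′ (p : c < rowLen (θ n) r) (p′ : c′ < rowLen (θ n) r) → c < c′ →
                  valueAt (r , c , p) < valueAt (r , c′ , p′)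
    valueAt-row zero c c′ p p′ c<c′ =
      valueAt-< (0 , c , p) (subst (c <_) (sym (valueAt-rank (0 , c′ , p′))) c<c′)
    valueAt-row (suc r) c zero p p′ ()
    valueAt-row (suc r) zero (suc c′) p p′ _ with θ-heart-position {n} {r} {c′} p′
    ... | refl , refl =
      valueAt-< (1 , 0 , p) (heart-after-leg (valueAt<size (1 , 1 , p′)) (valueAt-region (1 , 1 , p′)))
    valueAt-row (suc r) (suc c) (suc c′) p p′ c<c′
      with θ-heart-position {n} {r} {c} p | θ-heart-position {n} {r} {c′} p′
    ... | refl , refl | _ , refl = ⊥-elim (<-irrefl refl c<c′)

    valueAt-col : ∀ r r′ c (p : c < rowLen (θ n) r) (p′ : c < rowLen (θ n) r′) → r < r′ →
                  valueAt (r , c , p) < valueAt (r′ , c , p′)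
    valueAt-col r zero c p p′ ()
    valueAt-col zero (suc r′) zero p p′ _ =
      valueAt-< (0 , 0 , p) (count-< {P = cl is arm} (n≢0⇒n>0 leg≢0) (is-true {cl} starts-in-arm))
      where
      leg≢0 : valueAt (suc r′ , 0 , p′) ≢ 0
      leg≢0 eq with trans (sym starts-in-arm) (trans (cong cl (sym eq)) (valueAt-region (suc r′ , 0 , p′)))
      ... | ()
    valueAt-col (suc r) (suc r′) zero p p′ (s≤s r<r′) =
      valueAt-< (suc r , 0 , p) (subst (r <_) (sym (valueAt-rank (suc r′ , 0 , p′))) r<r′)
    valueAt-col zero (suc r′) (suc c) p p′ _ with θ-heart-position {n} {r′} {c} p′
    ... | refl , refl =
      valueAt-< (0 , 1 , p) (heart-after-arm (valueAt<size (1 , 1 , p′)) (valueAt-region (1 , 1 , p′)))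
    valueAt-col (suc r) (suc r′) (suc c) p p′ r<r′
      with θ-heart-position {n} {r} {c} p | θ-heart-position {n} {r′} {c} p′
    ... | refl , _ | refl , _ = ⊥-elim (<-irrefl refl r<r′)

    valueAt-injective : ∀ {x y} → valueAt x ≡ valueAt y → x ≡ y
    valueAt-injective {x} {y} eq = coordinates-injective ρ≡ i≡
      where
      open ≡-Reasoning
      ρ≡ : region x ≡ region y
      ρ≡ = trans (sym (valueAt-region x)) (trans (cong cl eq) (valueAt-region y))
      i≡ : index x ≡ index y
      i≡ = begin
        index x                            ≡⟨ valueAt-rank x ⟨
        count (cl is region x) (valueAt x) ≡⟨ cong₂ (λ ρ v → count (cl is ρ) v) ρ≡ eq ⟩
        count (cl is region y) (valueAt y) ≡⟨ valueAt-rank y ⟩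
        index y                            ∎

    valueAt-onto : ∀ {v} → v < size (θ n) → Σ (Cell (θ n)) λ x → valueAt x ≡ v
    valueAt-onto {v} v<size = cellAt (cl v) _ i<size , trans (valueAt-cellAt (cl v) i<size) selected≡v
      where
      P : ℕ → Bool
      P = cl is cl v
      i<size : count P v < regionSize n (cl v)
      i<size = subst (count P v <_) (region-count (cl v)) (count-< {P = P} v<size (is-true {cl} refl))
      selected≡v : proj₁ (select (cl v) i<size) ≡ v
      selected≡v = let _ , _ , Pu , rank = select (cl v) i<size in
                   count-injective {P = P} Pu (is-true {cl} refl) rank

    fillAt : Cell (θ n) → Fin (size (θ n))
    fillAt x = fromℕ< (valueAt<size x)

    toℕ-fillAt : ∀ x → toℕ (fillAt x) ≡ valueAt x
    toℕ-fillAt x = toℕ-fromℕ< (valueAt<size x)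

  tableau : SYT (θ n)
  tableau = record
    { fill      = fillAt
    ; fill-inj  = λ x y eq → valueAt-injective (trans (sym (toℕ-fillAt x)) (trans (cong toℕ eq) (toℕ-fillAt y)))
    ; fill-surj = λ k → let x , eq = valueAt-onto (toℕ<n k) in x , toℕ-injective (trans (toℕ-fillAt x) eq)
    ; row-incr  = λ r c c′ p p′ lt → on-fill (valueAt-row r c c′ p p′ lt)
    ; col-incr  = λ r r′ c p p′ lt → on-fill (valueAt-col r r′ c p p′ lt)
    }
    where
    on-fill : ∀ {x y} → valueAt x < valueAt y → toℕ (fillAt x) < toℕ (fillAt y)
    on-fill = subst₂ _<_ (sym (toℕ-fillAt _)) (sym (toℕ-fillAt _))

  regionOf-tableau : ∀ {v} → v < size (θ n) → regionOf tableau v ≡ cl v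
  regionOf-tableau v<size with cellOf tableau v<size
  ... | x , refl = trans (regionOf-value tableau x) (sym (trans (cong cl (toℕ-fillAt x)) (valueAt-region x)))

_=ˢ_ : Step → Step → Bool
N =ˢ N = true
S =ˢ S = true
E =ˢ E = true
W =ˢ W = true
_ =ˢ _ = false

=ˢ-refl : ∀ s → (s =ˢ s) ≡ true
=ˢ-refl N = refl
=ˢ-refl S = refl
=ˢ-refl E = refl
=ˢ-refl W = refl

steps : (ℕ → Step) → Step → ℕ → ℕ
steps f s = count (λ j → f j =ˢ s)

steps-zero : ∀ {f s m j} → steps f s m ≡ 0 → j < m → f j ≢ s
steps-zero {f} {j = j} none j<m refl with trans (sym (=ˢ-refl (f j))) (count-false none j<m)
... | ()

-- Before step j the walk is at (#E − #W , #N − #S), counting the first j steps;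
-- a backward step is safe when the coordinate it decreases is positive.
safe : Step → (ℕ → Step) → ℕ → Set
safe N _ _ = ⊤
safe E _ _ = ⊤
safe S f j = steps f S j < steps f N j
safe W f j = steps f W j < steps f E j

StaysInQuadrant : (ℕ → Step) → ℕ → Set
StaysInQuadrant f m = ∀ {j} → j < m → safe (f j) f j

EndsAt : (ℕ → Step) → ℕ → ℕ × ℕ → Set
EndsAt f m (x , y) = x + steps f W m ≡ steps f E m × y + steps f S m ≡ steps f N m

walk-++ : ∀ p xs ys → walk p (xs ++ ys) ≡ (walk p xs >>= λ q → walk q ys)
walk-++ p           []       ys = refl
walk-++ (x , y)     (N ∷ xs) ys = walk-++ (x , suc y) xs ys
walk-++ (x , y)     (E ∷ xs) ys = walk-++ (suc x , y) xs ys
walk-++ (x , zero)  (S ∷ xs) ys = refl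
walk-++ (x , suc y) (S ∷ xs) ys = walk-++ (x , y) xs ys
walk-++ (zero , y)  (W ∷ xs) ys = refl
walk-++ (suc x , y) (W ∷ xs) ys = walk-++ (x , y) xs ys

walk-applyUpTo-suc : ∀ f m → walk (0 , 0) (applyUpTo f (suc m)) ≡
                             (walk (0 , 0) (applyUpTo f m) >>= λ q → walk q (f m ∷ []))
walk-applyUpTo-suc f m =
  trans (cong (walk (0 , 0)) (sym (applyUpTo-∷ʳ f m))) (walk-++ (0 , 0) (applyUpTo f m) (f m ∷ []))

module _ (f : ℕ → Step) where

  private
    stays-suc : ∀ {m s} → StaysInQuadrant f m → f m ≡ s → safe s f m → StaysInQuadrant f (suc m)
    stays-suc stays refl ok {j} j<1+m with m≤n⇒m<n∨m≡n (s≤s⁻¹ j<1+m)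
    ... | inj₁ j<m  = stays j<m
    ... | inj₂ refl = ok

    step-invariant : ∀ m {x y x′ y′} → StaysInQuadrant f m → EndsAt f m (x , y) →
                     walk (x , y) (f m ∷ []) ≡ just (x′ , y′) →
                     StaysInQuadrant f (suc m) × EndsAt f (suc m) (x′ , y′)
    step-invariant m stays ends eq with f m in fm
    step-invariant m             stays (ex , ey) refl | E = stays-suc stays fm tt , cong suc ex , ey
    step-invariant m             stays (ex , ey) refl | N = stays-suc stays fm tt , ex , cong suc ey
    step-invariant m {y = zero}  stays (ex , ey) ()   | S
    step-invariant m {y = suc y} stays (ex , ey) refl | S =
      stays-suc stays fm (subst (steps f S m <_) ey (s≤s (m≤n+m _ y))) , ex , trans (+-suc y _) ey
    step-invariant m {x = zero}  stays (ex , ey) ()   | W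
    step-invariant m {x = suc x} stays (ex , ey) refl | W =
      stays-suc stays fm (subst (steps f W m <_) ex (s≤s (m≤n+m _ x))) , trans (+-suc x _) ex , ey

    step-succeeds : ∀ m {x y} → EndsAt f m (x , y) → safe (f m) f m →
                    ∃₂ λ x′ y′ → walk (x , y) (f m ∷ []) ≡ just (x′ , y′)
    step-succeeds m ends ok with f m
    step-succeeds m             _        _  | E = _ , _ , refl
    step-succeeds m             _        _  | N = _ , _ , refl
    step-succeeds m {y = zero}  (_ , ey) ok | S = ⊥-elim (<-irrefl ey ok)
    step-succeeds m {y = suc _} _        _  | S = _ , _ , refl
    step-succeeds m {x = zero}  (ex , _) ok | W = ⊥-elim (<-irrefl ex ok)
    step-succeeds m {x = suc _} _        _  | W = _ , _ , refl

  walk-invariant : ∀ m {x y} → walk (0 , 0) (applyUpTo f m) ≡ just (x , y) →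
                   StaysInQuadrant f m × EndsAt f m (x , y)
  walk-invariant zero refl = (λ ()) , refl , refl
  walk-invariant (suc m) eq rewrite walk-applyUpTo-suc f m with walk (0 , 0) (applyUpTo f m) in prefix
  walk-invariant (suc m) () | nothing
  walk-invariant (suc m) eq | just (x , y) =
    let stays , ends = walk-invariant m prefix in step-invariant m stays ends eq

  private
    walk-succeeds : ∀ m → StaysInQuadrant f m → ∃₂ λ x y → walk (0 , 0) (applyUpTo f m) ≡ just (x , y)
    walk-succeeds zero    _     = _ , _ , refl
    walk-succeeds (suc m) stays with walk-succeeds m (λ j<m → stays (m≤n⇒m≤1+n j<m))
    ... | x , y , prefix with step-succeeds m (proj₂ (walk-invariant m prefix)) (stays ≤-refl)
    ...   | x′ , y′ , last = x′ , y′ , trans (walk-applyUpTo-suc f m)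
                                         (trans (cong (_>>= λ q → walk q (f m ∷ [])) prefix) last)

  walk-endpoint : ∀ m {x y} → StaysInQuadrant f m → EndsAt f m (x , y) →
                  walk (0 , 0) (applyUpTo f m) ≡ just (x , y)
  walk-endpoint m stays (ex , ey) with walk-succeeds m stays
  ... | x′ , y′ , walk≡ with walk-invariant m walk≡
  ...   | _ , ex′ , ey′ = trans walk≡ (cong just (cong₂ _,_ (+-cancelʳ-≡ _ _ _ (trans ex′ (sym ex)))
                                                             (+-cancelʳ-≡ _ _ _ (trans ey′ (sym ey)))))

  steps-total : ∀ k → steps f E k + steps f N k + steps f S k + steps f W k ≡ k
  steps-total zero = refl
  steps-total (suc k) with f k
  ... | E = cong suc (steps-total k)
  ... | N = trans (cong (λ a → a + steps f S k + steps f W k) (+-suc (steps f E k) _)) (cong suc (steps-total k))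
  ... | S = trans (cong (_+ steps f W k) (+-suc (steps f E k + steps f N k) _)) (cong suc (steps-total k))
  ... | W = trans (+-suc (steps f E k + steps f N k + steps f S k) _) (cong suc (steps-total k))

  backward-steps : ∀ {n} → EndsAt f (2 * n + 2) (n , n) → steps f S (2 * n + 2) + steps f W (2 * n + 2) ≡ 1
  backward-steps {n} (ex , ey) = +-cancelˡ-≡ n _ _ (*-cancelˡ-≡ _ _ 2 (begin
    2 * (n + (s + w))         ≡⟨ arith n s w ⟩
    (n + w) + (n + s) + s + w ≡⟨ cong₂ (λ e n′ → e + n′ + s + w) ex ey ⟩
    e + steps f N m + s + w   ≡⟨ steps-total m ⟩
    2 * n + 2                 ≡⟨ *-distribˡ-+ 2 n 1 ⟨
    2 * (n + 1)               ∎))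
    where
    open ≡-Reasoning
    m e s w : ℕ
    m = 2 * n + 2
    e = steps f E m
    s = steps f S m
    w = steps f W m
    arith : ∀ n s w → 2 * (n + (s + w)) ≡ (n + w) + (n + s) + s + w
    arith = solve-∀

-- The flag b stands for "2 ∈ arm(T)".
letter : Bool → Region → Step
letter _     arm   = E
letter _     leg   = N
letter true  heart = S
letter false heart = W

stepRegion : Step → Region
stepRegion N = leg
stepRegion E = arm
stepRegion S = heart
stepRegion W = heart

stepRegion-letter : ∀ b ρ → stepRegion (letter b ρ) ≡ ρ
stepRegion-letter _     arm   = refl
stepRegion-letter _     leg   = refl
stepRegion-letter true  heart = refl
stepRegion-letter false heart = refl

letter-stepRegion : ∀ b s → (s =ˢ letter (not b) heart) ≡ false → letter b (stepRegion s) ≡ s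
letter-stepRegion _     N _  = refl
letter-stepRegion _     E _  = refl
letter-stepRegion true  S _  = refl
letter-stepRegion false W _  = refl
letter-stepRegion true  W ()
letter-stepRegion false S ()

twoInArm : (ℕ → Region) → Bool
twoInArm cl = cl 1 =ᴿ arm

pathOf : (ℕ → Region) → ℕ → Step
pathOf cl j = letter (twoInArm cl) (cl (2 + j))

wordOf : ∀ n → (ℕ → Region) → Word n
wordOf n cl = tabulate (λ j → pathOf cl (toℕ j))

decode : Bool → (ℕ → Step) → ℕ → Region
decode _ _ zero          = arm
decode b _ (suc zero)    = if b then arm else leg
decode _ f (suc (suc j)) = stepRegion (f j)

Compatible : Bool → (ℕ → Step) → ℕ → Set
Compatible b f m = steps f (letter (not b) heart) m ≡ 0

module _ {n : ℕ} (f : ℕ → Step) where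

  private
    m : ℕ
    m = 2 * n + 2

    same-count : ∀ s → (stepRegion s =ᴿ arm) ≡ (s =ˢ E) × (stepRegion s =ᴿ leg) ≡ (s =ˢ N)
    same-count N = refl , refl
    same-count E = refl , refl
    same-count S = refl , refl
    same-count W = refl , refl

    count-hearts : ∀ k → count (λ j → stepRegion (f j) =ᴿ heart) k ≡ steps f S k + steps f W k
    count-hearts zero = refl
    count-hearts (suc k) with f k
    ... | N = count-hearts k
    ... | E = count-hearts k
    ... | S = cong suc (count-hearts k)
    ... | W = trans (cong suc (count-hearts k)) (sym (+-suc _ _))

    arms : ∀ b k → count (decode b f is arm) (2 + k) ≡ count (decode b f is arm) 2 + steps f E k
    arms b k = trans (count-+ (decode b f is arm) 2 k)
                     (cong (count (decode b f is arm) 2 +_) (count-cong k λ {j} _ → proj₁ (same-count (f j))))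

    legs : ∀ b k → count (decode b f is leg) (2 + k) ≡ count (decode b f is leg) 2 + steps f N k
    legs b k = trans (count-+ (decode b f is leg) 2 k)
                     (cong (count (decode b f is leg) 2 +_) (count-cong k λ {j} _ → proj₂ (same-count (f j))))

    hearts : ∀ b k → count (decode b f is heart) (2 + k) ≡ steps f S k + steps f W k
    hearts true  k = trans (count-+ (decode true f is heart) 2 k) (count-hearts k)
    hearts false k = trans (count-+ (decode false f is heart) 2 k) (count-hearts k)

    heart-step : ∀ {b j} → decode b f (2 + j) ≡ heart → f j ≡ S ⊎ f j ≡ W
    heart-step {j = j} isHeart with f j
    ... | S = inj₁ refl
    ... | W = inj₂ refl

    below-size : ∀ {j} → 2 + j < size (θ n) → j < m
    below-size {j} lt = s≤s⁻¹ (s≤s⁻¹ (subst (2 + j <_) (size-θ n) lt))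

  decode-admissible⇒path : ∀ b → Admissible n (decode b f) → Compatible b f m →
                           StaysInQuadrant f m × EndsAt f m (n , n)
  decode-admissible⇒path true adm noW = stays , ends
    where
    open Admissible adm
    #E : steps f E m ≡ n
    #E = +-cancelˡ-≡ 2 _ _ (trans (sym (arms true m)) (trans (region-count-θ adm arm) (+-comm n 2)))
    #N : steps f N m ≡ suc n
    #N = trans (sym (legs true m)) (region-count-θ adm leg)
    #S : steps f S m ≡ 1
    #S = trans (sym (+-identityʳ _))
               (trans (cong (steps f S m +_) (sym noW)) (trans (sym (hearts true m)) (region-count-θ adm heart)))
    ends : EndsAt f m (n , n)
    ends = trans (cong (n +_) noW) (trans (+-identityʳ n) (sym #E))
         , trans (cong (n +_) #S) (trans (+-comm n 1) (sym #N))
    stays : StaysInQuadrant f m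
    stays {j} j<m with f j in fj
    ... | N = tt
    ... | E = tt
    ... | W = ⊥-elim (steps-zero noW j<m fj)
    ... | S = subst (_< steps f N j) (sym noS) (subst (1 ≤_) (legs true j) (heart-after-leg 2+j<size isHeart))
      where
      2+j<size : 2 + j < size (θ n)
      2+j<size = <size {n} (s≤s (s≤s j<m))
      isHeart : decode true f (2 + j) ≡ heart
      isHeart = cong stepRegion fj
      noS : steps f S j ≡ 0
      noS = m+n≡0⇒m≡0 _ (trans (sym (hearts true j)) (no-heart-before-heart adm 2+j<size isHeart))
  decode-admissible⇒path false adm noS = stays , ends
    where
    open Admissible adm
    #E : steps f E m ≡ suc n
    #E = suc-injective (trans (sym (arms false m)) (trans (region-count-θ adm arm) (+-comm n 2)))
    #N : steps f N m ≡ n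
    #N = suc-injective (trans (sym (legs false m)) (region-count-θ adm leg))
    #W : steps f W m ≡ 1
    #W = trans (cong (_+ steps f W m) (sym noS)) (trans (sym (hearts false m)) (region-count-θ adm heart))
    ends : EndsAt f m (n , n)
    ends = trans (cong (n +_) #W) (trans (+-comm n 1) (sym #E))
         , trans (cong (n +_) noS) (trans (+-identityʳ n) (sym #N))
    stays : StaysInQuadrant f m
    stays {j} j<m with f j in fj
    ... | N = tt
    ... | E = tt
    ... | S = ⊥-elim (steps-zero noS j<m fj)
    ... | W = subst (_< steps f E j) (sym noW)
                    (s≤s⁻¹ (subst (2 ≤_) (arms false j) (heart-after-arm 2+j<size isHeart)))
      where
      2+j<size : 2 + j < size (θ n)
      2+j<size = <size {n} (s≤s (s≤s j<m))
      isHeart : decode false f (2 + j) ≡ heart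
      isHeart = cong stepRegion fj
      noW : steps f W j ≡ 0
      noW = m+n≡0⇒n≡0 _ (trans (sym (hearts false j)) (no-heart-before-heart adm 2+j<size isHeart))

  path⇒decode-admissible : ∀ b → StaysInQuadrant f m → EndsAt f m (n , n) → Compatible b f m →
                           Admissible n (decode b f)
  path⇒decode-admissible true stays ends@(ex , ey) noW = record
    { starts-in-arm   = refl
    ; region-count    = λ ρ → subst (λ k → count (decode true f is ρ) k ≡ regionSize n ρ)
                                    (sym (size-θ n)) (counts ρ)
    ; heart-after-leg = after-leg
    ; heart-after-arm = after-arm
    }
    where
    #S : steps f S m ≡ 1
    #S = trans (sym (+-identityʳ _)) (trans (cong (steps f S m +_) (sym noW)) (backward-steps f {n} ends))
    counts : ∀ ρ → count (decode true f is ρ) (2 + m) ≡ regionSize n ρ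
    counts arm   = trans (arms true m) (trans (cong (2 +_) (trans (sym ex) (trans (cong (n +_) noW) (+-identityʳ n))))
                                              (+-comm 2 n))
    counts leg   = trans (legs true m) (trans (sym ey) (trans (cong (n +_) #S) (+-comm n 1)))
    counts heart = trans (hearts true m) (backward-steps f {n} ends)
    after-leg : ∀ {v} → v < size (θ n) → decode true f v ≡ heart → 1 ≤ count (decode true f is leg) v
    after-leg {suc (suc j)} v<size isHeart with heart-step {true} {j} isHeart
    ... | inj₁ fj = subst (1 ≤_) (sym (legs true j))
                          (<-≤-trans (s≤s z≤n) (subst (λ s → safe s f j) fj (stays (below-size v<size))))
    ... | inj₂ fj = ⊥-elim (steps-zero noW (below-size v<size) fj)
    after-arm : ∀ {v} → v < size (θ n) → decode true f v ≡ heart → 2 ≤ count (decode true f is arm) v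
    after-arm {suc (suc j)} _ _ = subst (2 ≤_) (sym (arms true j)) (m≤m+n 2 _)
  path⇒decode-admissible false stays ends@(ex , ey) noS = record
    { starts-in-arm   = refl
    ; region-count    = λ ρ → subst (λ k → count (decode false f is ρ) k ≡ regionSize n ρ)
                                    (sym (size-θ n)) (counts ρ)
    ; heart-after-leg = after-leg
    ; heart-after-arm = after-arm
    }
    where
    #W : steps f W m ≡ 1
    #W = trans (cong (_+ steps f W m) (sym noS)) (backward-steps f {n} ends)
    counts : ∀ ρ → count (decode false f is ρ) (2 + m) ≡ regionSize n ρ
    counts arm   = trans (arms false m) (trans (cong suc (trans (sym ex) (cong (n +_) #W))) (sym (+-suc n 1)))
    counts leg   = trans (legs false m) (cong suc (trans (sym ey) (trans (cong (n +_) noS) (+-identityʳ n))))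
    counts heart = trans (hearts false m) (backward-steps f {n} ends)
    after-leg : ∀ {v} → v < size (θ n) → decode false f v ≡ heart → 1 ≤ count (decode false f is leg) v
    after-leg {suc (suc j)} _ _ = subst (1 ≤_) (sym (legs false j)) (s≤s z≤n)
    after-arm : ∀ {v} → v < size (θ n) → decode false f v ≡ heart → 2 ≤ count (decode false f is arm) v
    after-arm {suc (suc j)} v<size isHeart with heart-step {false} {j} isHeart
    ... | inj₂ fj = subst (2 ≤_) (sym (arms false j))
                          (s≤s (<-≤-trans (s≤s z≤n) (subst (λ s → safe s f j) fj (stays (below-size v<size)))))
    ... | inj₁ fj = ⊥-elim (steps-zero noS (below-size v<size) fj)

decode-pathOf : ∀ {n cl} → Admissible n cl → ∀ v → cl v ≡ decode (twoInArm cl) (pathOf cl) v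
decode-pathOf adm zero = Admissible.starts-in-arm adm
decode-pathOf {cl = cl} adm (suc zero) with cl 1 in second
... | arm   = refl
... | leg   = refl
... | heart = ⊥-elim (second-not-heart adm second)
decode-pathOf {cl = cl} adm (suc (suc j)) = sym (stepRegion-letter (twoInArm cl) (cl (2 + j)))

compatible-pathOf : ∀ cl m → Compatible (twoInArm cl) (pathOf cl) m
compatible-pathOf cl m = count-interval {P = λ j → pathOf cl j =ˢ letter (not (twoInArm cl)) heart} {b = m} z≤n
                           λ {u} _ _ → clash (twoInArm cl) (cl (2 + u))
  where
  clash : ∀ b ρ → (letter b ρ =ˢ letter (not b) heart) ≡ false
  clash true  arm   = refl
  clash true  leg   = refl
  clash true  heart = refl
  clash false arm   = refl
  clash false leg   = refl
  clash false heart = refl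

compatible-unique : ∀ {f m} b b′ → steps f S m + steps f W m ≡ 1 →
                    Compatible b f m → Compatible b′ f m → b ≡ b′
compatible-unique true  true  _   _   _   = refl
compatible-unique false false _   _   _   = refl
compatible-unique true  false one noW noS = ⊥-elim (0≢1+n (trans (sym (cong₂ _+_ noS noW)) one))
compatible-unique false true  one noS noW = ⊥-elim (0≢1+n (trans (sym (cong₂ _+_ noS noW)) one))

toList-tabulate : ∀ {A : Set} (f : ℕ → A) {m} →
                  toList (tabulate {n = m} (λ j → f (toℕ j))) ≡ applyUpTo f m
toList-tabulate f {zero}  = refl
toList-tabulate f {suc m} = cong (f 0 ∷_) (toList-tabulate (λ j → f (suc j)))

module _ {n} {cl : ℕ → Region} (adm : Admissible n cl) where

  pathOf-stays-ends : StaysInQuadrant (pathOf cl) (2 * n + 2) × EndsAt (pathOf cl) (2 * n + 2) (n , n)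
  pathOf-stays-ends = decode-admissible⇒path (pathOf cl) (twoInArm cl)
                        (Admissible-cong (decode-pathOf adm) adm) (compatible-pathOf cl (2 * n + 2))

  wordOf-path : InP n (wordOf n cl)
  wordOf-path = trans (cong (walk (0 , 0)) (toList-tabulate (pathOf cl) {2 * n + 2}))
                      (walk-endpoint (pathOf cl) (2 * n + 2) (proj₁ pathOf-stays-ends) (proj₂ pathOf-stays-ends))

wordOf-injective : ∀ {n cl cl′} → Admissible n cl → Admissible n cl′ → wordOf n cl ≡ wordOf n cl′ →
                   ∀ {v} → v < size (θ n) → cl v ≡ cl′ v
wordOf-injective {n} {cl} {cl′} adm adm′ eq {v} v<size = begin
  cl v                                 ≡⟨ decode-pathOf adm v ⟩
  decode (twoInArm cl) (pathOf cl) v   ≡⟨ decode-cong (subst (v <_) (size-θ n) v<size) ⟩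
  decode (twoInArm cl′) (pathOf cl′) v ≡⟨ decode-pathOf adm′ v ⟨
  cl′ v                                ∎
  where
  open ≡-Reasoning
  m : ℕ
  m = 2 * n + 2
  same-path : ∀ {j} → j < m → pathOf cl j ≡ pathOf cl′ j
  same-path {j} j<m = subst (λ k → pathOf cl k ≡ pathOf cl′ k) (toℕ-fromℕ< j<m)
    (trans (sym (lookup∘tabulate _ i)) (trans (cong (λ w → lookup w i) eq) (lookup∘tabulate _ i)))
    where
    i : Fin m
    i = fromℕ< j<m
  same-flag : twoInArm cl ≡ twoInArm cl′
  same-flag = compatible-unique {pathOf cl} {m} (twoInArm cl) (twoInArm cl′)
                (backward-steps (pathOf cl) {n} (proj₂ (pathOf-stays-ends adm)))
                (compatible-pathOf cl m)
                (trans (count-cong m λ j<m → cong (_=ˢ _) (same-path j<m)) (compatible-pathOf cl′ m))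
  decode-cong : ∀ {v} → v < 2 + m →
                decode (twoInArm cl) (pathOf cl) v ≡ decode (twoInArm cl′) (pathOf cl′) v
  decode-cong {zero}        _  = refl
  decode-cong {suc zero}    _  = cong (λ b → if b then arm else leg) same-flag
  decode-cong {suc (suc j)} lt = cong stepRegion (same-path (s≤s⁻¹ (s≤s⁻¹ lt)))

wordOf-cong : ∀ {n cl cl′} → (∀ {v} → v < size (θ n) → cl v ≡ cl′ v) → wordOf n cl ≡ wordOf n cl′
wordOf-cong {n} same = tabulate-cong λ j →
  cong₂ letter (cong (_=ᴿ arm) (same (<size {n} (s≤s (s≤s z≤n)))))
               (same (<size {n} (s≤s (s≤s (toℕ<n j)))))

-- E is an arbitrary default beyond the end of the word.
stepAt : ∀ {m} → Vec Step m → ℕ → Step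
stepAt []      _       = E
stepAt (s ∷ _) zero    = s
stepAt (_ ∷ w) (suc j) = stepAt w j

toList-stepAt : ∀ {m} (w : Vec Step m) → toList w ≡ applyUpTo (stepAt w) m
toList-stepAt []      = refl
toList-stepAt (s ∷ w) = cong (s ∷_) (toList-stepAt w)

stepAt-lookup : ∀ {m} (w : Vec Step m) j → stepAt w (toℕ j) ≡ lookup w j
stepAt-lookup (s ∷ w) Fin.zero    = refl
stepAt-lookup (s ∷ w) (Fin.suc j) = stepAt-lookup w j

pathOf-decode : ∀ b f j → (f j =ˢ letter (not b) heart) ≡ false → pathOf (decode b f) j ≡ f j
pathOf-decode true  f j ok = letter-stepRegion true  (f j) ok
pathOf-decode false f j ok = letter-stepRegion false (f j) ok

path-regions : ∀ {n} (w : Word n) → InP n w → Σ (ℕ → Region) λ cl → Admissible n cl × wordOf n cl ≡ w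
path-regions {n} w inP = decode b f , path⇒decode-admissible f b stays ends compatible , decode-word
  where
  m : ℕ
  m = 2 * n + 2
  f : ℕ → Step
  f = stepAt w
  stays-ends : StaysInQuadrant f m × EndsAt f m (n , n)
  stays-ends = walk-invariant f m (trans (cong (walk (0 , 0)) (sym (toList-stepAt w))) inP)
  stays : StaysInQuadrant f m
  stays = proj₁ stays-ends
  ends : EndsAt f m (n , n)
  ends = proj₂ stays-ends
  choice : Σ Bool λ b → Compatible b f m
  choice with steps f S m in noS | backward-steps f {n} ends
  ... | zero  | _   = false , noS
  ... | suc _ | one = true , m+n≡0⇒n≡0 _ (suc-injective one)
  b : Bool
  b = proj₁ choice
  compatible : Compatible b f m
  compatible = proj₂ choice
  decode-word : wordOf n (decode b f) ≡ w
  decode-word = trans (tabulate-cong λ j → trans (pathOf-decode b f (toℕ j) (count-false compatible (toℕ<n j)))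
                                                 (stepAt-lookup w j))
                      (tabulate∘lookup w)

module _ {n} (T : SYT (θ n)) where

  private
    region-entry : ∀ {x v} → entry T x ≡ suc v → regionOf T v ≡ region x
    region-entry {x} eq = trans (cong (regionOf T) (sym (suc-injective eq))) (regionOf-value T x)

    cellIn : ∀ {v ρ} → v < size (θ n) → regionOf T v ≡ ρ →
             Σ (Cell (θ n)) λ x → entry T x ≡ suc v × region x ≡ ρ
    cellIn v<size eq with cellOf T v<size
    ... | x , refl = x , refl , trans (sym (regionOf-value T x)) eq

    inArm⇒ : ∀ {v} → InArm T (suc v) → regionOf T v ≡ arm
    inArm⇒ (c , p , eq) = region-entry eq

    inLeg⇒ : ∀ {v} → InLeg T (suc (suc v)) → regionOf T (suc v) ≡ leg
    inLeg⇒ (zero  , p , eq) = ⊥-elim (0≢1+n (trans (sym (value-corner T p)) (suc-injective eq)))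
    inLeg⇒ (suc r , p , eq) = region-entry eq

    ⇒inArm : ∀ {v} → v < size (θ n) → regionOf T v ≡ arm → InArm T (suc v)
    ⇒inArm v<size eq with cellIn v<size eq
    ... | (zero  , c     , p) , e , _ = c , p , e
    ... | (suc _ , zero  , _) , _ , ()
    ... | (suc _ , suc _ , _) , _ , ()

    ⇒inLeg : ∀ {v} → v < size (θ n) → regionOf T v ≡ leg → InLeg T (suc v)
    ⇒inLeg v<size eq with cellIn v<size eq
    ... | (suc r , zero  , p) , e , _ = suc r , p , e
    ... | (zero  , _     , _) , _ , ()
    ... | (suc _ , suc _ , _) , _ , ()

    ⇒isHeart : ∀ {v} → v < size (θ n) → regionOf T v ≡ heart → IsHeart T (suc v)
    ⇒isHeart v<size eq with cellIn v<size eq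
    ... | x , e , isHeart = trans (cong (entry T) (sym (region≡heart x isHeart))) e

    1<size : 1 < size (θ n)
    1<size = <size {n} (s≤s (s≤s z≤n))

    offset : ∀ (j : Fin (2 * n + 2)) → toℕ j + 3 ≡ suc (2 + toℕ j)
    offset j = +-comm (toℕ j) 3

  ψRel-wordOf : ψRel n T (wordOf n (regionOf T))
  ψRel-wordOf j rewrite lookup∘tabulate (λ j → pathOf (regionOf T) (toℕ j)) j | offset j =
      (λ a → cong (letter _) (inArm⇒ a))
    , (λ l → cong (letter _) (inLeg⇒ l))
    , (λ h a → cong₂ letter (cong (_=ᴿ arm) (inArm⇒ a)) (region-entry h))
    , (λ h l → cong₂ letter (cong (_=ᴿ arm) (inLeg⇒ l)) (region-entry h))

  ψRel⇒≡wordOf : ∀ w → ψRel n T w → w ≡ wordOf n (regionOf T)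
  ψRel⇒≡wordOf w ψ = trans (sym (tabulate∘lookup w)) (tabulate-cong letterAt)
    where
    letterAt : ∀ j → lookup w j ≡ pathOf (regionOf T) (toℕ j)
    letterAt j with ψ j | <size {n} (s≤s (s≤s (toℕ<n j))) | regionOf T (2 + toℕ j) in ρ
    ... | isE , _ , _ , _ | v<size | arm = isE (subst (InArm T) (sym (offset j)) (⇒inArm v<size ρ))
    ... | _ , isN , _ , _ | v<size | leg = isN (subst (InLeg T) (sym (offset j)) (⇒inLeg v<size ρ))
    ... | _ , _ , isS , isW | v<size | heart
        with regionOf T 1 in ρ₁ | subst (IsHeart T) (sym (offset j)) (⇒isHeart v<size ρ)
    ...   | arm   | h = isS h (⇒inArm 1<size ρ₁)
    ...   | leg   | h = isW h (⇒inLeg 1<size ρ₁)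
    ...   | heart | _ = ⊥-elim (second-not-heart (regionOf-admissible T) ρ₁)

theorem3p1 : (n : ℕ) →
    ((T : SYT (θ n)) → Σ (Word n) (λ w → ψRel n T w × InP n w × ((w' : Word n) → ψRel n T w' → w' ≡ w)))
    × ((T T' : SYT (θ n)) (w : Word n) → ψRel n T w → ψRel n T' w → SameSYT T T')
    × ((w : Word n) → InP n w → Σ (SYT (θ n)) (λ T → ψRel n T w))
theorem3p1 n =
    (λ T → wordOf n (regionOf T) , ψRel-wordOf T , wordOf-path (regionOf-admissible T) , ψRel⇒≡wordOf T)
  , (λ T T′ w ψ ψ′ → same-regions⇒SameSYT T T′
       (wordOf-injective (regionOf-admissible T) (regionOf-admissible T′)
         (trans (sym (ψRel⇒≡wordOf T w ψ)) (ψRel⇒≡wordOf T′ w ψ′))))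
  , (λ w inP → let cl , adm , word = path-regions w inP ; open FromRegions adm in
       tableau , subst (ψRel n tableau) (trans (wordOf-cong regionOf-tableau) word) (ψRel-wordOf tableau))
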